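{- Let $A$ be a tournament on strategies $\{1,\dots,m\}$ with Nash equilibrium $\vec a$, and let $B$ be a tournament on strategies $\{1',\dots,n'\}$ with Nash equilibrium $\vec b$. Let $C$ be the tournament obtained from $A$ by substituting $B$ for strategy $m$: its strategies are $1,\dots,m-1,1',\dots,n'$; for $i,j\le m-1$, $i$ beats $j$ in $C$ iff $i$ beats $j$ in $A$; for $k',l'$ strategies of $B$, $k'$ beats $l'$ in $C$ iff $k'$ beats $l'$ in $B$; and for $i\le m-1$ and any $k'$, $i$ beats $k'$ in $C$ iff $i$ beats $m$ in $A$ (otherwise $k'$ beats $i$). Then the Nash equilibrium of $C$ (with strategies ordered $1,\dots,m-1,1',\dots,n'$) is $\langle a_1,a_2,\dots,a_{m-1},a_mb_1,a_mb_2,\dots,a_mb_n\rangle$.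
   Context: A Rock Paper Scissors variant is given by a tournament on a finite set of strategies: for distinct strategies $i,j$ exactly one of "$i$ beats $j$" or "$j$ beats $i$" holds. Define $g_{ij}=2$ if $i$ beats $j$, $g_{ii}=1$, and $g_{ij}=0$ if $j$ beats $i$. A strategy profile is a vector of nonnegative probabilities indexed by the strategies summing to $1$. A Nash equilibrium is a strategy profile $\vec a$ such that for every strategy profile $\vec b$, $\sum_{i,j} g_{ij}a_ib_j\ge 1$; such games have a unique Nash equilibrium.
   Formalization: All strategy profiles take values in the rationals: the equilibria $\vec a$ and $\vec b$, the profile of C, and the opponent profiles against which the Nash condition is tested. -}

module Defs where

open import Data.Nat using (ℕ; zero; suc) renaming (_+_ to _+ℕ_)
open import Data.Fin using (Fin; zero; suc; inject₁; fromℕ; splitAt; _≟_)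
open import Data.Bool using (Bool; true; false; not; if_then_else_)
open import Data.Sum using (_⊎_; inj₁; inj₂)
open import Data.Product using (_×_)
open import Data.Rational using (ℚ; 0ℚ; 1ℚ; _+_; _*_; _≤_)
open import Relation.Nullary using (yes; no)
open import Relation.Binary.PropositionalEquality using (_≡_; _≢_)

-- A tournament on strategies Fin m: for distinct i j, exactly one of
-- "i beats j", "j beats i" holds.  (The diagonal value is irrelevant.)
record Tournament (m : ℕ) : Set where
  field
    beats : Fin m → Fin m → Bool
    exactlyOne : ∀ i j → i ≢ j → beats j i ≡ not (beats i j)
open Tournament public

2ℚ : ℚ
2ℚ = 1ℚ + 1ℚ

payoff : ∀ {k} → (Fin k → Fin k → Bool) → Fin k → Fin k → ℚ
payoff bt i j with i ≟ j
... | yes _ = 1ℚ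
... | no _ = if bt i j then 2ℚ else 0ℚ

Σ : ∀ {k} → (Fin k → ℚ) → ℚ
Σ {zero} f = 0ℚ
Σ {suc k} f = f zero + Σ (λ i → f (suc i))

IsProfile : ∀ {k} → (Fin k → ℚ) → Set
IsProfile a = (∀ i → 0ℚ ≤ a i) × (Σ a ≡ 1ℚ)

IsNash : ∀ {k} → (Fin k → Fin k → Bool) → (Fin k → ℚ) → Set
IsNash {k} bt a = IsProfile a ×
  ((b : Fin k → ℚ) → IsProfile b →
     1ℚ ≤ Σ (λ i → Σ (λ j → payoff bt i j * a i * b j)))

-- Substitution of B (strategies Fin n) for the last strategy m of A
-- (strategies Fin (suc m')); C has strategies Fin (m' +ℕ n), ordered
-- 1,…,m-1 (via inj₁) then 1',…,n' (via inj₂).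
substBeats : ∀ {m' n} → Tournament (suc m') → Tournament n →
             Fin (m' +ℕ n) → Fin (m' +ℕ n) → Bool
substBeats {m'} A B x y with splitAt m' x | splitAt m' y
... | inj₁ i | inj₁ j = beats A (inject₁ i) (inject₁ j)
... | inj₂ k | inj₂ l = beats B k l
... | inj₁ i | inj₂ k = beats A (inject₁ i) (fromℕ m')
... | inj₂ k | inj₁ i = not (beats A (inject₁ i) (fromℕ m'))

substProfile : ∀ {m' n} → (Fin (suc m') → ℚ) → (Fin n → ℚ) →
               Fin (m' +ℕ n) → ℚ
substProfile {m'} a b x with splitAt m' x
... | inj₁ i = a (inject₁ i)
... | inj₂ k = a (fromℕ m') * b k

{-# OPTIONS --safe #-}
module Submission where

-- A profile is a Nash equilibrium iff it earns at least 1 against every pure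
-- strategy, because the expected payoff is linear in the opponent's profile.
-- Against a pure strategy of C coming from A, the profile c = ⟨a₁,…,a_{m-1},a_m b⟩
-- earns exactly what a earns against it in A (B is played with total weight a_m
-- and meets every such strategy as m would).  Against a strategy k' of B it earns
-- Σ_{i<m} g_{im} a_i + a_m · (what b earns against k' in B), which is at least
-- Σ_{i<m} g_{im} a_i + a_m, i.e. what a earns against m in A.

open import Defs
open import Algebra.Bundles using (CommutativeMonoid; CommutativeRing)
open import Data.Bool using (Bool; if_then_else_)
open import Data.Empty using (⊥-elim)
open import Data.Fin using (Fin; zero; suc; _↑ˡ_; _↑ʳ_; inject₁; fromℕ; splitAt) renaming (_≟_ to _≟ᶠ_)
open import Data.Fin.Properties
  using (↑ˡ-injective; ↑ʳ-injective; inject₁-injective; fromℕ≢inject₁; splitAt-↑ˡ; splitAt-↑ʳ; splitAt⁻¹-↑ˡ; splitAt⁻¹-↑ʳ)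
open import Data.Nat using (ℕ; suc) renaming (_+_ to _+ℕ_)
open import Data.Product using (_,_; proj₁; proj₂)
open import Data.Rational using (ℚ; 0ℚ; 1ℚ; _+_; _*_; _≤_; nonNegative)
open import Data.Rational.Properties
open import Data.Sum using (inj₁; inj₂)
open import Function using (_∘_; id)
open import Function.Definitions using (Injective)
open import Relation.Binary.PropositionalEquality
open import Relation.Nullary using (yes; no)

open import Algebra.Properties.Semiring.Sum (CommutativeRing.semiring +-*-commutativeRing)
  using (sum; ∑-comm; *-distribˡ-sum; *-distribʳ-sum; sum-init-last)
open import Algebra.Properties.CommutativeSemigroup (CommutativeMonoid.commutativeSemigroup *-1-commutativeMonoid)
  using (x∙yz≈y∙xz)

private
  variable
    k l m' n : ℕ

Σ≡sum : (f : Fin k → ℚ) → Σ f ≡ sum f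
Σ≡sum {ℕ.zero} f = refl
Σ≡sum {suc k} f = cong (f zero +_) (Σ≡sum (f ∘ suc))

Σ-cong : {f g : Fin k → ℚ} → (∀ i → f i ≡ g i) → Σ f ≡ Σ g
Σ-cong {ℕ.zero} e = refl
Σ-cong {suc k} e = cong₂ _+_ (e zero) (Σ-cong (e ∘ suc))

Σ-mono-≤ : {f g : Fin k → ℚ} → (∀ i → f i ≤ g i) → Σ f ≤ Σ g
Σ-mono-≤ {ℕ.zero} h = ≤-refl
Σ-mono-≤ {suc k} h = +-mono-≤ (h zero) (Σ-mono-≤ (h ∘ suc))

Σ-*ˡ : (c : ℚ) (f : Fin k → ℚ) → Σ (λ i → c * f i) ≡ c * Σ f
Σ-*ˡ c f = begin
  Σ (λ i → c * f i) ≡⟨ Σ≡sum (λ i → c * f i) ⟩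
  sum (λ i → c * f i) ≡⟨ *-distribˡ-sum c f ⟨
  c * sum f ≡⟨ cong (c *_) (Σ≡sum f) ⟨
  c * Σ f ∎
  where open ≡-Reasoning

Σ-*ʳ : (c : ℚ) (f : Fin k → ℚ) → Σ (λ i → f i * c) ≡ Σ f * c
Σ-*ʳ c f = begin
  Σ (λ i → f i * c) ≡⟨ Σ≡sum (λ i → f i * c) ⟩
  sum (λ i → f i * c) ≡⟨ *-distribʳ-sum c f ⟨
  sum f * c ≡⟨ cong (_* c) (Σ≡sum f) ⟨
  Σ f * c ∎
  where open ≡-Reasoning

Σ-comm : (f : Fin k → Fin l → ℚ) → Σ (λ i → Σ (f i)) ≡ Σ (λ j → Σ (λ i → f i j))
Σ-comm f = begin
  Σ (λ i → Σ (f i)) ≡⟨ Σ≡sum² f ⟩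
  sum (λ i → sum (f i)) ≡⟨ ∑-comm f ⟩
  sum (λ j → sum (λ i → f i j)) ≡⟨ Σ≡sum² (λ j i → f i j) ⟨
  Σ (λ j → Σ (λ i → f i j)) ∎
  where
  open ≡-Reasoning
  Σ≡sum² : ∀ {k l} (g : Fin k → Fin l → ℚ) → Σ (λ i → Σ (g i)) ≡ sum (λ i → sum (g i))
  Σ≡sum² g = trans (Σ-cong (Σ≡sum ∘ g)) (Σ≡sum (λ i → sum (g i)))

Σ-init-last : (f : Fin (suc k) → ℚ) → Σ f ≡ Σ (f ∘ inject₁) + f (fromℕ k)
Σ-init-last f = begin
  Σ f ≡⟨ Σ≡sum f ⟩
  sum f ≡⟨ sum-init-last f ⟩
  sum (f ∘ inject₁) + f (fromℕ _) ≡⟨ cong (_+ f (fromℕ _)) (Σ≡sum (f ∘ inject₁)) ⟨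
  Σ (f ∘ inject₁) + f (fromℕ _) ∎
  where open ≡-Reasoning

Σ-split : ∀ m' (f : Fin (m' +ℕ n) → ℚ) → Σ f ≡ Σ (λ i → f (i ↑ˡ n)) + Σ (λ k → f (m' ↑ʳ k))
Σ-split ℕ.zero f = sym (+-identityˡ (Σ f))
Σ-split (suc m') f = trans (cong (f zero +_) (Σ-split m' (f ∘ suc))) (sym (+-assoc (f zero) _ _))

pureProfile : Fin k → Fin k → ℚ
pureProfile zero zero = 1ℚ
pureProfile zero (suc _) = 0ℚ
pureProfile (suc _) zero = 0ℚ
pureProfile (suc j) (suc i) = pureProfile j i

Σ-*-pureProfile : (f : Fin k → ℚ) (j : Fin k) → Σ (λ i → f i * pureProfile j i) ≡ f j
Σ-*-pureProfile {suc k} f zero = begin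
  f zero * 1ℚ + Σ (λ i → f (suc i) * 0ℚ) ≡⟨ cong₂ _+_ (*-identityʳ (f zero)) (Σ-*ʳ 0ℚ (f ∘ suc)) ⟩
  f zero + Σ (f ∘ suc) * 0ℚ ≡⟨ cong (f zero +_) (*-zeroʳ (Σ (f ∘ suc))) ⟩
  f zero + 0ℚ ≡⟨ +-identityʳ (f zero) ⟩
  f zero ∎
  where open ≡-Reasoning
Σ-*-pureProfile {suc k} f (suc j) = begin
  f zero * 0ℚ + Σ (λ i → f (suc i) * pureProfile j i)
    ≡⟨ cong₂ _+_ (*-zeroʳ (f zero)) (Σ-*-pureProfile (f ∘ suc) j) ⟩
  0ℚ + f (suc j) ≡⟨ +-identityˡ (f (suc j)) ⟩
  f (suc j) ∎
  where open ≡-Reasoning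

pureProfile-nonNeg : (j i : Fin k) → 0ℚ ≤ pureProfile j i
pureProfile-nonNeg zero zero = nonNegative⁻¹ 1ℚ
pureProfile-nonNeg zero (suc _) = ≤-refl
pureProfile-nonNeg (suc _) zero = ≤-refl
pureProfile-nonNeg (suc j) (suc i) = pureProfile-nonNeg j i

pureProfile-isProfile : (j : Fin k) → IsProfile (pureProfile j)
pureProfile-isProfile j =
  pureProfile-nonNeg j , trans (Σ-cong (sym ∘ *-identityˡ ∘ pureProfile j)) (Σ-*-pureProfile (λ _ → 1ℚ) j)

expectedPayoff : (Fin k → Fin k → Bool) → (Fin k → ℚ) → (Fin k → ℚ) → ℚ
expectedPayoff bt a b = Σ (λ i → Σ (λ j → payoff bt i j * a i * b j))

payoffAgainstPure : (Fin k → Fin k → Bool) → (Fin k → ℚ) → Fin k → ℚ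
payoffAgainstPure bt a j = Σ (λ i → payoff bt i j * a i)

expectedPayoff-linear : (bt : Fin k → Fin k → Bool) (a b : Fin k → ℚ) →
                        expectedPayoff bt a b ≡ Σ (λ j → payoffAgainstPure bt a j * b j)
expectedPayoff-linear bt a b =
  trans (Σ-comm (λ i j → payoff bt i j * a i * b j))
        (Σ-cong (λ j → Σ-*ʳ (b j) (λ i → payoff bt i j * a i)))

IsNash⇒1≤payoffAgainstPure : {bt : Fin k → Fin k → Bool} {a : Fin k → ℚ} →
                             IsNash bt a → ∀ j → 1ℚ ≤ payoffAgainstPure bt a j
IsNash⇒1≤payoffAgainstPure {bt = bt} {a} (_ , nash) j =
  subst (1ℚ ≤_) expectedPayoff-pureProfile (nash (pureProfile j) (pureProfile-isProfile j))
  where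
  expectedPayoff-pureProfile : expectedPayoff bt a (pureProfile j) ≡ payoffAgainstPure bt a j
  expectedPayoff-pureProfile =
    trans (expectedPayoff-linear bt a (pureProfile j)) (Σ-*-pureProfile (payoffAgainstPure bt a) j)

1≤payoffAgainstPure⇒IsNash : {bt : Fin k → Fin k → Bool} {a : Fin k → ℚ} →
                             IsProfile a → (∀ j → 1ℚ ≤ payoffAgainstPure bt a j) → IsNash bt a
1≤payoffAgainstPure⇒IsNash {bt = bt} {a} profile 1≤payoff = profile , λ b (b≥0 , Σb≡1) → begin
  1ℚ ≡⟨ Σb≡1 ⟨
  Σ b ≡⟨ Σ-cong (sym ∘ *-identityˡ ∘ b) ⟩
  Σ (λ j → 1ℚ * b j) ≤⟨ Σ-mono-≤ (λ j → *-monoʳ-≤-nonNeg (b j) {{nonNegative (b≥0 j)}} (1≤payoff j)) ⟩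
  Σ (λ j → payoffAgainstPure bt a j * b j) ≡⟨ expectedPayoff-linear bt a b ⟨
  expectedPayoff bt a b ∎
  where open ≤-Reasoning

payoff-refl : (bt : Fin k → Fin k → Bool) (i : Fin k) → payoff bt i i ≡ 1ℚ
payoff-refl bt i with i ≟ᶠ i
... | yes _ = refl
... | no i≢i = ⊥-elim (i≢i refl)

payoff-≢ : (bt : Fin k → Fin k → Bool) {i j : Fin k} → i ≢ j → payoff bt i j ≡ (if bt i j then 2ℚ else 0ℚ)
payoff-≢ bt {i} {j} i≢j with i ≟ᶠ j
... | yes i≡j = ⊥-elim (i≢j i≡j)
... | no _ = refl

payoff-≢-cong : (bt : Fin k → Fin k → Bool) (bt′ : Fin l → Fin l → Bool) {i j : Fin k} {i′ j′ : Fin l} →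
                i ≢ j → i′ ≢ j′ → bt i j ≡ bt′ i′ j′ → payoff bt i j ≡ payoff bt′ i′ j′
payoff-≢-cong bt bt′ {i} {j} {i′} {j′} i≢j i′≢j′ eq = begin
  payoff bt i j ≡⟨ payoff-≢ bt i≢j ⟩
  (if bt i j then 2ℚ else 0ℚ) ≡⟨ cong (if_then 2ℚ else 0ℚ) eq ⟩
  (if bt′ i′ j′ then 2ℚ else 0ℚ) ≡⟨ payoff-≢ bt′ i′≢j′ ⟨
  payoff bt′ i′ j′ ∎
  where open ≡-Reasoning

payoff-reindex : (bt : Fin k → Fin k → Bool) (bt′ : Fin l → Fin l → Bool)
                 {f : Fin m' → Fin k} {g : Fin m' → Fin l} → Injective _≡_ _≡_ f → Injective _≡_ _≡_ g →
                 (∀ i j → bt (f i) (f j) ≡ bt′ (g i) (g j)) →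
                 ∀ i j → payoff bt (f i) (f j) ≡ payoff bt′ (g i) (g j)
payoff-reindex bt bt′ {f} {g} f-inj g-inj eq i j with i ≟ᶠ j
... | yes refl = trans (payoff-refl bt (f i)) (sym (payoff-refl bt′ (g i)))
... | no i≢j = payoff-≢-cong bt bt′ (i≢j ∘ f-inj) (i≢j ∘ g-inj) (eq i j)

↑ˡ≢↑ʳ : (i : Fin m') (k : Fin n) → i ↑ˡ n ≢ m' ↑ʳ k
↑ˡ≢↑ʳ {m'} {n} i k eq with trans (sym (splitAt-↑ˡ m' i n)) (trans (cong (splitAt m') eq) (splitAt-↑ʳ m' n k))
... | ()

↑-elim : (P : Fin (m' +ℕ n) → Set) → (∀ i → P (i ↑ˡ n)) → (∀ k → P (m' ↑ʳ k)) → ∀ x → P x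
↑-elim {m'} P left right x with splitAt m' x in eq
... | inj₁ i = subst P (splitAt⁻¹-↑ˡ eq) (left i)
... | inj₂ k = subst P (splitAt⁻¹-↑ʳ eq) (right k)

module _ {m' n : ℕ} (a : Fin (suc m') → ℚ) (b : Fin n → ℚ) where

  private
    aₘ : ℚ
    aₘ = a (fromℕ m')

  substProfile-↑ˡ : ∀ i → substProfile a b (i ↑ˡ n) ≡ a (inject₁ i)
  substProfile-↑ˡ i rewrite splitAt-↑ˡ m' i n = refl

  substProfile-↑ʳ : ∀ k → substProfile a b (m' ↑ʳ k) ≡ aₘ * b k
  substProfile-↑ʳ k rewrite splitAt-↑ʳ m' n k = refl

  Σ-*-substProfile : (h : Fin (m' +ℕ n) → ℚ) →
                     Σ (λ x → h x * substProfile a b x)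
                       ≡ Σ (λ i → h (i ↑ˡ n) * a (inject₁ i)) + aₘ * Σ (λ k → h (m' ↑ʳ k) * b k)
  Σ-*-substProfile h = begin
    Σ (λ x → h x * substProfile a b x)
      ≡⟨ Σ-split m' (λ x → h x * substProfile a b x) ⟩
    Σ (λ i → h (i ↑ˡ n) * substProfile a b (i ↑ˡ n)) + Σ (λ k → h (m' ↑ʳ k) * substProfile a b (m' ↑ʳ k))
      ≡⟨ cong₂ _+_ (Σ-cong (cong (h (_ ↑ˡ n) *_) ∘ substProfile-↑ˡ))
                   (Σ-cong (cong (h (m' ↑ʳ _) *_) ∘ substProfile-↑ʳ)) ⟩
    S + Σ (λ k → h (m' ↑ʳ k) * (aₘ * b k))
      ≡⟨ cong (S +_) (Σ-cong (λ k → x∙yz≈y∙xz (h (m' ↑ʳ k)) aₘ (b k))) ⟩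
    S + Σ (λ k → aₘ * (h (m' ↑ʳ k) * b k))
      ≡⟨ cong (S +_) (Σ-*ˡ aₘ (λ k → h (m' ↑ʳ k) * b k)) ⟩
    S + aₘ * Σ (λ k → h (m' ↑ʳ k) * b k) ∎
    where
    open ≡-Reasoning
    S : ℚ
    S = Σ (λ i → h (i ↑ˡ n) * a (inject₁ i))

  substProfile-isProfile : IsProfile a → IsProfile b → IsProfile (substProfile a b)
  substProfile-isProfile (a≥0 , Σa≡1) (b≥0 , Σb≡1) = nonNeg , sum≡1
    where
    nonNeg : ∀ x → 0ℚ ≤ substProfile a b x
    nonNeg x with splitAt m' x
    ... | inj₁ i = a≥0 (inject₁ i)
    ... | inj₂ k =
      nonNegative⁻¹ _ {{nonNeg*nonNeg⇒nonNeg aₘ {{nonNegative (a≥0 _)}} (b k) {{nonNegative (b≥0 k)}}}}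
    open ≡-Reasoning
    sum≡1 : Σ (substProfile a b) ≡ 1ℚ
    sum≡1 = begin
      Σ (substProfile a b) ≡⟨ Σ-cong (sym ∘ *-identityˡ ∘ substProfile a b) ⟩
      Σ (λ x → 1ℚ * substProfile a b x) ≡⟨ Σ-*-substProfile (λ _ → 1ℚ) ⟩
      Σ (λ i → 1ℚ * a (inject₁ i)) + aₘ * Σ (λ k → 1ℚ * b k)
        ≡⟨ cong₂ (λ s t → s + aₘ * t) (Σ-cong (*-identityˡ ∘ a ∘ inject₁)) (Σ-cong (*-identityˡ ∘ b)) ⟩
      Σ (a ∘ inject₁) + aₘ * Σ b ≡⟨ cong (λ t → Σ (a ∘ inject₁) + aₘ * t) Σb≡1 ⟩
      Σ (a ∘ inject₁) + aₘ * 1ℚ ≡⟨ cong (Σ (a ∘ inject₁) +_) (*-identityʳ aₘ) ⟩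
      Σ (a ∘ inject₁) + aₘ ≡⟨ Σ-init-last a ⟨
      Σ a ≡⟨ Σa≡1 ⟩
      1ℚ ∎

payoffAgainstPure-fromℕ : (bt : Fin (suc m') → Fin (suc m') → Bool) (a : Fin (suc m') → ℚ) →
                          payoffAgainstPure bt a (fromℕ m')
                            ≡ Σ (λ i → payoff bt (inject₁ i) (fromℕ m') * a (inject₁ i)) + a (fromℕ m')
payoffAgainstPure-fromℕ {m'} bt a =
  trans (Σ-init-last (λ i → payoff bt i (fromℕ m') * a i))
        (cong (Σ (λ i → payoff bt (inject₁ i) (fromℕ m') * a (inject₁ i)) +_)
              (trans (cong (_* a (fromℕ m')) (payoff-refl bt (fromℕ m'))) (*-identityˡ (a (fromℕ m')))))

module _ {m' n : ℕ} (A : Tournament (suc m')) (B : Tournament n) where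

  private
    C : Fin (m' +ℕ n) → Fin (m' +ℕ n) → Bool
    C = substBeats A B

  substBeats-↑ˡ↑ˡ : ∀ i j → C (i ↑ˡ n) (j ↑ˡ n) ≡ beats A (inject₁ i) (inject₁ j)
  substBeats-↑ˡ↑ˡ i j rewrite splitAt-↑ˡ m' i n | splitAt-↑ˡ m' j n = refl

  substBeats-↑ʳ↑ʳ : ∀ k l → C (m' ↑ʳ k) (m' ↑ʳ l) ≡ beats B k l
  substBeats-↑ʳ↑ʳ k l rewrite splitAt-↑ʳ m' n k | splitAt-↑ʳ m' n l = refl

  substBeats-↑ˡ↑ʳ : ∀ i k → C (i ↑ˡ n) (m' ↑ʳ k) ≡ beats A (inject₁ i) (fromℕ m')
  substBeats-↑ˡ↑ʳ i k rewrite splitAt-↑ˡ m' i n | splitAt-↑ʳ m' n k = refl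

  substBeats-↑ʳ↑ˡ : ∀ k i → C (m' ↑ʳ k) (i ↑ˡ n) ≡ beats A (fromℕ m') (inject₁ i)
  substBeats-↑ʳ↑ˡ k i rewrite splitAt-↑ʳ m' n k | splitAt-↑ˡ m' i n =
    sym (exactlyOne A (inject₁ i) (fromℕ m') (fromℕ≢inject₁ ∘ sym))

  payoff-substBeats-↑ˡ↑ˡ : ∀ i j → payoff C (i ↑ˡ n) (j ↑ˡ n) ≡ payoff (beats A) (inject₁ i) (inject₁ j)
  payoff-substBeats-↑ˡ↑ˡ = payoff-reindex C (beats A) (↑ˡ-injective n _ _) inject₁-injective substBeats-↑ˡ↑ˡ

  payoff-substBeats-↑ʳ↑ʳ : ∀ k l → payoff C (m' ↑ʳ k) (m' ↑ʳ l) ≡ payoff (beats B) k l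
  payoff-substBeats-↑ʳ↑ʳ = payoff-reindex C (beats B) (↑ʳ-injective m' _ _) id substBeats-↑ʳ↑ʳ

  payoff-substBeats-↑ˡ↑ʳ : ∀ i k → payoff C (i ↑ˡ n) (m' ↑ʳ k) ≡ payoff (beats A) (inject₁ i) (fromℕ m')
  payoff-substBeats-↑ˡ↑ʳ i k =
    payoff-≢-cong C (beats A) (↑ˡ≢↑ʳ i k) (fromℕ≢inject₁ ∘ sym) (substBeats-↑ˡ↑ʳ i k)

  payoff-substBeats-↑ʳ↑ˡ : ∀ k i → payoff C (m' ↑ʳ k) (i ↑ˡ n) ≡ payoff (beats A) (fromℕ m') (inject₁ i)
  payoff-substBeats-↑ʳ↑ˡ k i =
    payoff-≢-cong C (beats A) (↑ˡ≢↑ʳ i k ∘ sym) fromℕ≢inject₁ (substBeats-↑ʳ↑ˡ k i)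

  module _ (a : Fin (suc m') → ℚ) (b : Fin n → ℚ) where

    private
      c : Fin (m' +ℕ n) → ℚ
      c = substProfile a b
      aₘ : ℚ
      aₘ = a (fromℕ m')

    payoffAgainstPure-substBeats-↑ˡ : Σ b ≡ 1ℚ →
      ∀ j → payoffAgainstPure C c (j ↑ˡ n) ≡ payoffAgainstPure (beats A) a (inject₁ j)
    payoffAgainstPure-substBeats-↑ˡ Σb≡1 j = begin
      payoffAgainstPure C c (j ↑ˡ n)
        ≡⟨ Σ-*-substProfile a b (λ x → payoff C x (j ↑ˡ n)) ⟩
      Σ (λ i → payoff C (i ↑ˡ n) (j ↑ˡ n) * a (inject₁ i)) + aₘ * Σ (λ k → payoff C (m' ↑ʳ k) (j ↑ˡ n) * b k)
        ≡⟨ cong₂ (λ s t → s + aₘ * t)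
                 (Σ-cong (λ i → cong (_* a (inject₁ i)) (payoff-substBeats-↑ˡ↑ˡ i j)))
                 (Σ-cong (λ k → cong (_* b k) (payoff-substBeats-↑ʳ↑ˡ k j))) ⟩
      S + aₘ * Σ (λ k → gₘⱼ * b k)
        ≡⟨ cong (λ t → S + aₘ * t) (trans (Σ-*ˡ gₘⱼ b) (trans (cong (gₘⱼ *_) Σb≡1) (*-identityʳ gₘⱼ))) ⟩
      S + aₘ * gₘⱼ ≡⟨ cong (S +_) (*-comm aₘ gₘⱼ) ⟩
      S + gₘⱼ * aₘ ≡⟨ Σ-init-last (λ i → payoff (beats A) i (inject₁ j) * a i) ⟨
      payoffAgainstPure (beats A) a (inject₁ j) ∎
      where
      open ≡-Reasoning
      S gₘⱼ : ℚ
      S = Σ (λ i → payoff (beats A) (inject₁ i) (inject₁ j) * a (inject₁ i))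
      gₘⱼ = payoff (beats A) (fromℕ m') (inject₁ j)

    payoffAgainstPure-substBeats-↑ʳ : ∀ l →
      payoffAgainstPure C c (m' ↑ʳ l)
        ≡ Σ (λ i → payoff (beats A) (inject₁ i) (fromℕ m') * a (inject₁ i))
          + aₘ * payoffAgainstPure (beats B) b l
    payoffAgainstPure-substBeats-↑ʳ l =
      trans (Σ-*-substProfile a b (λ x → payoff C x (m' ↑ʳ l)))
            (cong₂ (λ s t → s + aₘ * t)
                   (Σ-cong (λ i → cong (_* a (inject₁ i)) (payoff-substBeats-↑ˡ↑ʳ i l)))
                   (Σ-cong (λ k → cong (_* b k) (payoff-substBeats-↑ʳ↑ʳ k l))))

    1≤payoffAgainstPure-substBeats-↑ˡ : IsNash (beats A) a → Σ b ≡ 1ℚ →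
      ∀ j → 1ℚ ≤ payoffAgainstPure C c (j ↑ˡ n)
    1≤payoffAgainstPure-substBeats-↑ˡ nashA Σb≡1 j =
      subst (1ℚ ≤_) (sym (payoffAgainstPure-substBeats-↑ˡ Σb≡1 j)) (IsNash⇒1≤payoffAgainstPure nashA (inject₁ j))

    1≤payoffAgainstPure-substBeats-↑ʳ : IsNash (beats A) a → IsNash (beats B) b →
      ∀ l → 1ℚ ≤ payoffAgainstPure C c (m' ↑ʳ l)
    1≤payoffAgainstPure-substBeats-↑ʳ nashA nashB l = begin
      1ℚ ≤⟨ IsNash⇒1≤payoffAgainstPure nashA (fromℕ m') ⟩
      payoffAgainstPure (beats A) a (fromℕ m') ≡⟨ payoffAgainstPure-fromℕ (beats A) a ⟩
      S + aₘ ≡⟨ cong (S +_) (*-identityʳ aₘ) ⟨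
      S + aₘ * 1ℚ ≤⟨ +-monoʳ-≤ S (*-monoˡ-≤-nonNeg aₘ {{nonNegative aₘ≥0}} (IsNash⇒1≤payoffAgainstPure nashB l)) ⟩
      S + aₘ * payoffAgainstPure (beats B) b l ≡⟨ payoffAgainstPure-substBeats-↑ʳ l ⟨
      payoffAgainstPure C c (m' ↑ʳ l) ∎
      where
      open ≤-Reasoning
      S : ℚ
      S = Σ (λ i → payoff (beats A) (inject₁ i) (fromℕ m') * a (inject₁ i))
      aₘ≥0 : 0ℚ ≤ aₘ
      aₘ≥0 = proj₁ (proj₁ nashA) (fromℕ m')

theorem3p2 : (m' n : ℕ) (A : Tournament (suc m')) (B : Tournament n)
    (a : Fin (suc m') → ℚ) (b : Fin n → ℚ) →
    IsNash (beats A) a → IsNash (beats B) b →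
    IsNash (substBeats A B) (substProfile a b)
theorem3p2 m' n A B a b nashA@(profileA , _) nashB@(profileB@(_ , Σb≡1) , _) =
  1≤payoffAgainstPure⇒IsNash (substProfile-isProfile a b profileA profileB)
    (↑-elim (λ x → 1ℚ ≤ payoffAgainstPure (substBeats A B) (substProfile a b) x)
            (1≤payoffAgainstPure-substBeats-↑ˡ A B a b nashA Σb≡1)
            (1≤payoffAgainstPure-substBeats-↑ʳ A B a b nashA nashB))
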